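{- Let $G$ be a weak framework for a matroid $M$ and let $e$ be a non-loop-edge of $G$. Then $G/e$ is a weak framework for $M/e$.
   Context: For a graph $G$ and a vertex $v$, $\mathrm{loops}_G(v)$ denotes the set of loop-edges of $G$ at $v$. Graphs are finite and may have loops and parallel edges. A graph $G$ is a weak framework for a matroid $M$ if (1) $E(G)=E(M)$; (2) $r_M(E(H))\le |V(H)|$ for each component $H$ of $G$; and (3) for each vertex $v$ of $G$, $\mathrm{cl}_M(E(G-v))\subseteq E(G-v)\cup \mathrm{loops}_G(v)$. $G/e$ denotes the graph obtained by contracting the edge $e$. -}

module Defs where

open import Data.Nat using (ℕ; _≤_; _+_; _∸_)
open import Data.Bool using (Bool; true; false; _∧_; not; if_then_else_)
open import Data.Fin using (Fin; _≟_)
open import Data.Fin.Subset using (Subset; inside; outside; _∈_; _⊆_; _∪_; _∩_; ∁; ⁅_⁆; ∣_∣)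
open import Data.Vec using (tabulate; lookup)
open import Data.Product using (_×_; _,_; proj₁; proj₂; ∃)
open import Data.Sum using (_⊎_)
open import Relation.Nullary using (¬_)
open import Relation.Nullary.Decidable using (⌊_⌋)
open import Relation.Binary.PropositionalEquality using (_≡_; _≢_)
open import Relation.Binary.Construct.Closure.ReflexiveTransitive using (Star)
open import Function.Bundles using (_⇔_)

record MatroidData (m : ℕ) : Set where
  field
    ground : Subset m
    rank   : Subset m → ℕ
open MatroidData public

record IsMatroid {m : ℕ} (M : MatroidData m) : Set where
  field
    r-card  : ∀ X → X ⊆ ground M → rank M X ≤ ∣ X ∣
    r-mono  : ∀ X Y → Y ⊆ ground M → X ⊆ Y → rank M X ≤ rank M Y
    r-submod : ∀ X Y → X ⊆ ground M → Y ⊆ ground M →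
               rank M (X ∪ Y) + rank M (X ∩ Y) ≤ rank M X + rank M Y

InCl : {m : ℕ} → MatroidData m → Subset m → Fin m → Set
InCl M X x = x ∈ ground M × rank M (X ∪ ⁅ x ⁆) ≡ rank M X

contractM : {m : ℕ} → MatroidData m → Fin m → MatroidData m
contractM M e = record
  { ground = ground M ∩ ∁ ⁅ e ⁆
  ; rank   = λ X → rank M (X ∪ ⁅ e ⁆) ∸ rank M ⁅ e ⁆ }

-- Graphs with loops and parallel edges.
-- Vertices form a subset of Fin n, edges a subset of Fin m; each edge has
-- two ends (equal ends = loop).

record Graph (n m : ℕ) : Set where
  field
    V    : Subset n
    E    : Subset m
    ends : Fin m → Fin n × Fin n
open Graph public

WellFormed : {n m : ℕ} → Graph n m → Set
WellFormed G = ∀ f → f ∈ E G → proj₁ (ends G f) ∈ V G × proj₂ (ends G f) ∈ V G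

IsLoop : {n m : ℕ} → Graph n m → Fin m → Set
IsLoop G f = proj₁ (ends G f) ≡ proj₂ (ends G f)

private
  memb : {k : ℕ} → Subset k → Fin k → Bool
  memb S i = lookup S i   -- Side = Bool, inside = true

  eqb : {k : ℕ} → Fin k → Fin k → Bool
  eqb i j = ⌊ i ≟ j ⌋

  subsetOf : {k : ℕ} → (Fin k → Bool) → Subset k
  subsetOf p = tabulate λ i → if p i then inside else outside

contractG : {n m : ℕ} → Graph n m → Fin m → Graph n m
contractG G e = record
  { V    = V G ∩ ∁ ⁅ v ⁆
  ; E    = E G ∩ ∁ ⁅ e ⁆
  ; ends = λ f → σ (proj₁ (ends G f)) , σ (proj₂ (ends G f)) }
  where
    u = proj₁ (ends G e)
    v = proj₂ (ends G e)
    σ : _ → _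
    σ w = if eqb w v then u else w

data Adj {n m : ℕ} (G : Graph n m) : Fin n → Fin n → Set where
  adj : ∀ f → f ∈ E G → Adj G (proj₁ (ends G f)) (proj₂ (ends G f))
  adj⁻ : ∀ f → f ∈ E G → Adj G (proj₂ (ends G f)) (proj₁ (ends G f))

Reach : {n m : ℕ} → Graph n m → Fin n → Fin n → Set
Reach G = Star (Adj G)

IsComponent : {n m : ℕ} → Graph n m → Subset n → Set
IsComponent G C = ∃ λ x → x ∈ V G × (∀ y → (y ∈ C) ⇔ Reach G x y)

edgesIn : {n m : ℕ} → Graph n m → Subset n → Subset m
edgesIn G C = subsetOf λ f → memb (E G) f ∧ memb C (proj₁ (ends G f)) ∧ memb C (proj₂ (ends G f))

edgesAvoid : {n m : ℕ} → Graph n m → Fin n → Subset m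
edgesAvoid G v = subsetOf λ f → memb (E G) f ∧ not (eqb (proj₁ (ends G f)) v) ∧ not (eqb (proj₂ (ends G f)) v)

loopsAt : {n m : ℕ} → Graph n m → Fin n → Subset m
loopsAt G v = subsetOf λ f → memb (E G) f ∧ eqb (proj₁ (ends G f)) v ∧ eqb (proj₂ (ends G f)) v

record WeakFramework {n m : ℕ} (G : Graph n m) (M : MatroidData m) : Set where
  field
    wf-edges : E G ≡ ground M
    wf-comp  : ∀ C → IsComponent G C → rank M (edgesIn G C) ≤ ∣ C ∣
    wf-cl    : ∀ v → v ∈ V G → ∀ f → InCl M (edgesAvoid G v) f →
               f ∈ edgesAvoid G v ⊎ f ∈ loopsAt G v

module Submission where

open import Defs
open import Data.Nat using (ℕ; zero; suc; _≤_; _<_; _+_; _∸_; z≤n; s≤s)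
import Data.Nat as ℕ
open import Data.Nat.Properties
  using (≤-trans; ≤-antisym; ≤-reflexive; m≤m+n; +-comm; +-suc; n≤1+n; +-identityʳ; +-cancelʳ-≤;
         +-mono-≤; +-monoʳ-≤; ≤∧≢⇒<; ∸-cancelʳ-≡; ∸-mono; m≤n+o⇒m∸n≤o; m+n∸n≡m; module ≤-Reasoning)
open import Data.Bool using (Bool; true; false; T; not; if_then_else_)
open import Data.Bool.Properties using (T-≡; T-∧)
open import Data.Fin using (Fin; _≟_)
open import Data.Fin.Subset using (Subset; inside; outside; _∈_; _∉_; _⊆_; _∪_; _∩_; ∁; ⁅_⁆; ∣_∣)
open import Data.Fin.Subset.Properties
  using (x∈⁅x⁆; x∈⁅y⁆⇒x≡y; x≢y⇒x∉⁅y⁆; x∉⁅y⁆⇒x≢y; x∈∁p⇒x∉p; x∉p⇒x∈∁p; x∈p∩q⁺; x∈p∩q⁻; p∩q⊆p;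
         x∈p∪q⁻; p⊆p∪q; q⊆p∪q; ∣⁅x⁆∣≡1; _∈?_; ∪-commutativeMonoid)
open import Algebra.Bundles using (CommutativeMonoid)
import Algebra.Properties.CommutativeSemigroup as CommutativeSemigroupProperties
open import Data.Vec using (_∷_; []; tabulate; lookup)
open import Data.Vec.Properties using ([]=⇒lookup; lookup⇒[]=; lookup∘tabulate)
open import Data.Product using (_×_; _,_; proj₁; proj₂)
open import Data.Product.Function.NonDependent.Propositional using (_×-⇔_)
open import Data.Sum using (_⊎_; inj₁; inj₂; [_,_])
open import Function using (_∘_; id)
open import Function.Bundles using (_⇔_; mk⇔; Equivalence)
import Function.Properties.Equivalence as ⇔
open import Relation.Nullary using (¬_; yes; no; contradiction)
open import Relation.Nullary.Decidable using (⌊_⌋; toWitness; fromWitness; toWitnessFalse; fromWitnessFalse)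
open import Relation.Binary.PropositionalEquality using (_≡_; _≢_; refl; sym; trans; cong; subst)
open import Relation.Binary.Construct.Closure.ReflexiveTransitive using (ε; _◅_; _◅◅_)

open Equivalence using (to; from)

-- Let u, v be the ends of e; G/e sends v to u. A component C' of G/e is the image of the
-- component C' ∪ {v} of G when u ∈ C' and of C' itself otherwise; in the first case the extra
-- vertex is paid for by r(e) ≥ 1, which holds because e ∉ cl(E(G - v)), e being no loop at v.
-- For the closure condition, f ∈ cl_{M/e}(X) with X = E(G/e - w) means f ∈ cl_M(X ∪ e). If w ≠ u
-- then X ∪ e ⊆ E(G - w) and the condition for G at w applies. If w = u then X lies in both
-- E(G - u) and E(G - v): either f ∈ cl_M(X), and the conditions at u and v combine, or by the
-- exchange property e ∈ cl_M(X ∪ f), so f cannot avoid u or v and becomes a loop at u in G/e.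

∣p∪q∣≤∣p∣+∣q∣ : ∀ {k} (p q : Subset k) → ∣ p ∪ q ∣ ≤ ∣ p ∣ + ∣ q ∣
∣p∪q∣≤∣p∣+∣q∣ []             []             = z≤n
∣p∪q∣≤∣p∣+∣q∣ (inside  ∷ p) (inside  ∷ q) = s≤s (≤-trans (∣p∪q∣≤∣p∣+∣q∣ p q) (+-monoʳ-≤ ∣ p ∣ (n≤1+n ∣ q ∣)))
∣p∪q∣≤∣p∣+∣q∣ (inside  ∷ p) (outside ∷ q) = s≤s (∣p∪q∣≤∣p∣+∣q∣ p q)
∣p∪q∣≤∣p∣+∣q∣ (outside ∷ p) (inside  ∷ q) = ≤-trans (s≤s (∣p∪q∣≤∣p∣+∣q∣ p q)) (≤-reflexive (sym (+-suc _ _)))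
∣p∪q∣≤∣p∣+∣q∣ (outside ∷ p) (outside ∷ q) = ∣p∪q∣≤∣p∣+∣q∣ p q

module _ {k : ℕ} where

  ∈⇔T-lookup : ∀ {p : Subset k} {x} → x ∈ p ⇔ T (lookup p x)
  ∈⇔T-lookup {p} {x} = ⇔.trans (mk⇔ []=⇒lookup (lookup⇒[]= x p)) (⇔.sym T-≡)

  ∈-tabulate⇔T : ∀ (b : Fin k → Bool) {x} → x ∈ tabulate (λ y → if b y then inside else outside) ⇔ T (b x)
  ∈-tabulate⇔T b {x} =
    subst (λ c → x ∈ tabulate g ⇔ T c) (trans (lookup∘tabulate g x) (if-inside-outside (b x))) ∈⇔T-lookup
    where
      g : Fin k → Bool
      g y = if b y then inside else outside
      if-inside-outside : ∀ c → (if c then inside else outside) ≡ c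
      if-inside-outside true  = refl
      if-inside-outside false = refl

  ∪-⊆ : ∀ {p q r : Subset k} → p ⊆ r → q ⊆ r → p ∪ q ⊆ r
  ∪-⊆ {p} {q} p⊆r q⊆r x∈p∪q = [ p⊆r , q⊆r ] (x∈p∪q⁻ p q x∈p∪q)

  ⁅⁆-⊆ : ∀ {p : Subset k} {x} → x ∈ p → ⁅ x ⁆ ⊆ p
  ⁅⁆-⊆ {p} {x} x∈p y∈⁅x⁆ = subst (_∈ p) (sym (x∈⁅y⁆⇒x≡y x y∈⁅x⁆)) x∈p

  ∈-∩∁⁅⁆ : ∀ {p : Subset k} {x y} → x ∈ p ∩ ∁ ⁅ y ⁆ ⇔ (x ∈ p × x ≢ y)
  ∈-∩∁⁅⁆ {p} {x} {y} = mk⇔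
    (λ h → let (x∈p , x∈∁) = x∈p∩q⁻ p (∁ ⁅ y ⁆) h in x∈p , x∉⁅y⁆⇒x≢y (x∈∁p⇒x∉p x∈∁))
    (λ (x∈p , x≢y) → x∈p∩q⁺ (x∈p , x∉p⇒x∈∁p (x≢y⇒x∉⁅y⁆ x≢y)))

module MatroidProperties {m : ℕ} {M : MatroidData m} (isM : IsMatroid M) where
  open IsMatroid isM
  open CommutativeSemigroupProperties (CommutativeMonoid.commutativeSemigroup (∪-commutativeMonoid m))
    using (xy∙z≈xz∙y)
  open ≤-Reasoning

  rank-∪≤ : ∀ {X Y} → X ⊆ ground M → Y ⊆ ground M → rank M (X ∪ Y) ≤ rank M X + rank M Y
  rank-∪≤ {X} {Y} X⊆ Y⊆ = ≤-trans (m≤m+n _ _) (r-submod X Y X⊆ Y⊆)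

  rank-≤-∪ : ∀ {X Y} → X ⊆ ground M → Y ⊆ ground M → rank M X ≤ rank M (X ∪ Y)
  rank-≤-∪ {X} {Y} X⊆ Y⊆ = r-mono X (X ∪ Y) (∪-⊆ X⊆ Y⊆) (p⊆p∪q Y)

  rank-⁅⁆≤1 : ∀ {x} → x ∈ ground M → rank M ⁅ x ⁆ ≤ 1
  rank-⁅⁆≤1 {x} x∈ = subst (rank M ⁅ x ⁆ ≤_) (∣⁅x⁆∣≡1 x) (r-card ⁅ x ⁆ (⁅⁆-⊆ x∈))

  InCl-mono : ∀ {Y Z f} → Y ⊆ Z → Z ⊆ ground M → InCl M Y f → InCl M Z f
  InCl-mono {Y} {Z} {f} Y⊆Z Z⊆ (f∈ , clY) =
    f∈ , ≤-antisym (+-cancelʳ-≤ (rank M Y) _ _ bound) (rank-≤-∪ Z⊆ (⁅⁆-⊆ f∈))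
    where
      Yf = Y ∪ ⁅ f ⁆
      Yf⊆ : Yf ⊆ ground M
      Yf⊆ = ∪-⊆ (Z⊆ ∘ Y⊆Z) (⁅⁆-⊆ f∈)
      Zf⊆Z∪Yf : Z ∪ ⁅ f ⁆ ⊆ Z ∪ Yf
      Zf⊆Z∪Yf = ∪-⊆ (p⊆p∪q Yf) (q⊆p∪q Z Yf ∘ q⊆p∪q Y ⁅ f ⁆)
      Y⊆Z∩Yf : Y ⊆ Z ∩ Yf
      Y⊆Z∩Yf y∈Y = x∈p∩q⁺ (Y⊆Z y∈Y , p⊆p∪q ⁅ f ⁆ y∈Y)
      bound : rank M (Z ∪ ⁅ f ⁆) + rank M Y ≤ rank M Z + rank M Y
      bound = begin
        rank M (Z ∪ ⁅ f ⁆) + rank M Y       ≤⟨ +-mono-≤ (r-mono _ _ (∪-⊆ Z⊆ Yf⊆) Zf⊆Z∪Yf)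
                                                         (r-mono _ _ (Z⊆ ∘ p∩q⊆p Z Yf) Y⊆Z∩Yf) ⟩
        rank M (Z ∪ Yf) + rank M (Z ∩ Yf)   ≤⟨ r-submod Z Yf Z⊆ Yf⊆ ⟩
        rank M Z + rank M Yf                ≡⟨ cong (rank M Z +_) clY ⟩
        rank M Z + rank M Y                 ∎

  InCl-exchange : ∀ {X e f} → X ⊆ ground M → e ∈ ground M →
                  InCl M (X ∪ ⁅ e ⁆) f → InCl M X f ⊎ InCl M (X ∪ ⁅ f ⁆) e
  InCl-exchange {X} {e} {f} X⊆ e∈ (f∈ , clXe) with rank M (X ∪ ⁅ f ⁆) ℕ.≟ rank M X
  ... | yes clX = inj₁ (f∈ , clX)
  ... | no ¬clX = inj₂ (e∈ , ≤-antisym bound (rank-≤-∪ (∪-⊆ X⊆ (⁅⁆-⊆ f∈)) (⁅⁆-⊆ e∈)))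
    where
      bound : rank M ((X ∪ ⁅ f ⁆) ∪ ⁅ e ⁆) ≤ rank M (X ∪ ⁅ f ⁆)
      bound = begin
        rank M ((X ∪ ⁅ f ⁆) ∪ ⁅ e ⁆)  ≡⟨ cong (rank M) (xy∙z≈xz∙y X ⁅ f ⁆ ⁅ e ⁆) ⟩
        rank M ((X ∪ ⁅ e ⁆) ∪ ⁅ f ⁆)  ≡⟨ clXe ⟩
        rank M (X ∪ ⁅ e ⁆)            ≤⟨ rank-∪≤ X⊆ (⁅⁆-⊆ e∈) ⟩
        rank M X + rank M ⁅ e ⁆       ≤⟨ +-monoʳ-≤ (rank M X) (rank-⁅⁆≤1 e∈) ⟩
        rank M X + 1                  ≡⟨ +-comm (rank M X) 1 ⟩
        suc (rank M X)                ≤⟨ ≤∧≢⇒< (rank-≤-∪ X⊆ (⁅⁆-⊆ f∈)) (¬clX ∘ sym) ⟩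
        rank M (X ∪ ⁅ f ⁆)            ∎

  ¬InCl⇒0<rank⁅⁆ : ∀ {X x} → X ⊆ ground M → x ∈ ground M → ¬ InCl M X x → 0 < rank M ⁅ x ⁆
  ¬InCl⇒0<rank⁅⁆ {X} {x} X⊆ x∈ ¬clX with rank M ⁅ x ⁆ in rank⁅x⁆≡
  ... | suc _ = s≤s z≤n
  ... | zero  = contradiction (x∈ , ≤-antisym bound (rank-≤-∪ X⊆ (⁅⁆-⊆ x∈))) ¬clX
    where
      bound : rank M (X ∪ ⁅ x ⁆) ≤ rank M X
      bound = begin
        rank M (X ∪ ⁅ x ⁆)       ≤⟨ rank-∪≤ X⊆ (⁅⁆-⊆ x∈) ⟩
        rank M X + rank M ⁅ x ⁆  ≡⟨ cong (rank M X +_) rank⁅x⁆≡ ⟩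
        rank M X + 0             ≡⟨ +-identityʳ (rank M X) ⟩
        rank M X                 ∎

  InCl-contract : ∀ {X e f} → X ⊆ ground M → e ∈ ground M →
                  InCl (contractM M e) X f → InCl M (X ∪ ⁅ e ⁆) f × f ≢ e
  InCl-contract {X} {e} {f} X⊆ e∈ (f∈' , cl) with to ∈-∩∁⁅⁆ f∈'
  ... | f∈ , f≢e = (f∈ , clXe) , f≢e
    where
      rank⁅e⁆≤ : ∀ {S} → S ⊆ ground M → rank M ⁅ e ⁆ ≤ rank M (S ∪ ⁅ e ⁆)
      rank⁅e⁆≤ {S} S⊆ = r-mono ⁅ e ⁆ (S ∪ ⁅ e ⁆) (∪-⊆ S⊆ (⁅⁆-⊆ e∈)) (q⊆p∪q S ⁅ e ⁆)
      clXe : rank M ((X ∪ ⁅ e ⁆) ∪ ⁅ f ⁆) ≡ rank M (X ∪ ⁅ e ⁆)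
      clXe = trans (cong (rank M) (xy∙z≈xz∙y X ⁅ e ⁆ ⁅ f ⁆))
                   (∸-cancelʳ-≡ (rank⁅e⁆≤ (∪-⊆ X⊆ (⁅⁆-⊆ f∈))) (rank⁅e⁆≤ X⊆) cl)

  rank-contract≤rank : ∀ {X e} → X ⊆ ground M → e ∈ ground M → rank (contractM M e) X ≤ rank M X
  rank-contract≤rank {X} {e} X⊆ e∈ =
    m≤n+o⇒m∸n≤o _ (rank M ⁅ e ⁆) (≤-trans (rank-∪≤ X⊆ (⁅⁆-⊆ e∈)) (≤-reflexive (+-comm (rank M X) _)))

end₁ end₂ : ∀ {n m} → Graph n m → Fin m → Fin n
end₁ G f = proj₁ (ends G f)
end₂ G f = proj₂ (ends G f)

module _ {n m : ℕ} (G : Graph n m) {f : Fin m} where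

  private
    T-⌊⌋ : ∀ {x y : Fin n} → T ⌊ x ≟ y ⌋ ⇔ (x ≡ y)
    T-⌊⌋ = mk⇔ toWitness fromWitness

    T-not-⌊⌋ : ∀ {x y : Fin n} → T (not ⌊ x ≟ y ⌋) ⇔ (x ≢ y)
    T-not-⌊⌋ = mk⇔ toWitnessFalse fromWitnessFalse

  ∈-edgesAvoid : ∀ {w} → f ∈ edgesAvoid G w ⇔ (f ∈ E G × end₁ G f ≢ w × end₂ G f ≢ w)
  ∈-edgesAvoid = ⇔.trans (∈-tabulate⇔T _)
    (⇔.trans T-∧ (⇔.sym ∈⇔T-lookup ×-⇔ ⇔.trans T-∧ (T-not-⌊⌋ ×-⇔ T-not-⌊⌋)))

  ∈-loopsAt : ∀ {w} → f ∈ loopsAt G w ⇔ (f ∈ E G × end₁ G f ≡ w × end₂ G f ≡ w)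
  ∈-loopsAt = ⇔.trans (∈-tabulate⇔T _)
    (⇔.trans T-∧ (⇔.sym ∈⇔T-lookup ×-⇔ ⇔.trans T-∧ (T-⌊⌋ ×-⇔ T-⌊⌋)))

  ∈-edgesIn : ∀ {C} → f ∈ edgesIn G C ⇔ (f ∈ E G × end₁ G f ∈ C × end₂ G f ∈ C)
  ∈-edgesIn = ⇔.trans (∈-tabulate⇔T _)
    (⇔.trans T-∧ (⇔.sym ∈⇔T-lookup ×-⇔ ⇔.trans T-∧ (⇔.sym ∈⇔T-lookup ×-⇔ ⇔.sym ∈⇔T-lookup)))

  ∉edgesAvoid⇒incident : ∀ {w} → f ∈ E G → f ∉ edgesAvoid G w → end₁ G f ≡ w ⊎ end₂ G f ≡ w
  ∉edgesAvoid⇒incident {w} f∈E f∉ with end₁ G f ≟ w | end₂ G f ≟ w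
  ... | yes end₁≡w | _          = inj₁ end₁≡w
  ... | no _       | yes end₂≡w = inj₂ end₂≡w
  ... | no end₁≢w  | no end₂≢w  = contradiction (from ∈-edgesAvoid (f∈E , end₁≢w , end₂≢w)) f∉

edgesIn⊆E : ∀ {n m} (G : Graph n m) C → edgesIn G C ⊆ E G
edgesIn⊆E G C = proj₁ ∘ to (∈-edgesIn G {C = C})

module Contraction {n m : ℕ} (G : Graph n m) (e : Fin m) where

  u v : Fin n
  u = end₁ G e
  v = end₂ G e

  G/e : Graph n m
  G/e = contractG G e

  -- The vertex map of contractG: ends G/e f unfolds to identify applied to ends G f.
  identify : Fin n → Fin n
  identify w = if ⌊ w ≟ v ⌋ then u else w

  identify-v : identify v ≡ u
  identify-v with v ≟ v
  ... | yes _   = refl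
  ... | no v≢v = contradiction refl v≢v

  identify-≢v : ∀ {w} → w ≢ v → identify w ≡ w
  identify-≢v {w} w≢v with w ≟ v
  ... | yes w≡v = contradiction w≡v w≢v
  ... | no _    = refl

  identify-u : identify u ≡ u
  identify-u with u ≟ v
  ... | yes _ = refl
  ... | no _  = refl

  identify-u≡identify-v : identify u ≡ identify v
  identify-u≡identify-v = trans identify-u (sym identify-v)

  identify-incident : ∀ {w} → w ≡ u ⊎ w ≡ v → identify w ≡ u
  identify-incident (inj₁ refl) = identify-u
  identify-incident (inj₂ refl) = identify-v

  identify≢v : u ≢ v → ∀ w → identify w ≢ v
  identify≢v u≢v w with w ≟ v
  ... | yes _   = u≢v
  ... | no w≢v = w≢v

  identify-≢ : ∀ {w z} → w ≢ u → z ≢ w → identify z ≢ w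
  identify-≢ {w} {z} w≢u z≢w with z ≟ v
  ... | yes _ = w≢u ∘ sym
  ... | no _  = z≢w

  identify-≢u : ∀ {z} → z ≢ u → z ≢ v → identify z ≢ u
  identify-≢u z≢u z≢v = subst (_≢ u) (sym (identify-≢v z≢v)) z≢u

  identify-≢⁻ : ∀ {w z} → w ≢ v → identify z ≢ w → z ≢ w
  identify-≢⁻ w≢v identify-z≢w refl = identify-z≢w (identify-≢v w≢v)

  identify-≢u⁻ : ∀ {z} → identify z ≢ u → z ≢ v
  identify-≢u⁻ identify-z≢u refl = identify-z≢u identify-v

  ∈-E/e : ∀ {f} → f ∈ E G/e ⇔ (f ∈ E G × f ≢ e)
  ∈-E/e = ∈-∩∁⁅⁆

  ∈-V/e : ∀ {w} → w ∈ V G/e ⇔ (w ∈ V G × w ≢ v)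
  ∈-V/e = ∈-∩∁⁅⁆

  edgesAvoid/e⊆edgesAvoid : ∀ {w} → w ≢ v → edgesAvoid G/e w ⊆ edgesAvoid G w
  edgesAvoid/e⊆edgesAvoid w≢v f∈ =
    let (f∈E/e , end₁≢w , end₂≢w) = to (∈-edgesAvoid G/e) f∈
    in from (∈-edgesAvoid G) (proj₁ (to ∈-E/e f∈E/e) , identify-≢⁻ w≢v end₁≢w , identify-≢⁻ w≢v end₂≢w)

  edgesAvoid/e-u⊆edgesAvoid-v : edgesAvoid G/e u ⊆ edgesAvoid G v
  edgesAvoid/e-u⊆edgesAvoid-v f∈ =
    let (f∈E/e , end₁≢u , end₂≢u) = to (∈-edgesAvoid G/e) f∈
    in from (∈-edgesAvoid G) (proj₁ (to ∈-E/e f∈E/e) , identify-≢u⁻ end₁≢u , identify-≢u⁻ end₂≢u)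

  edgesAvoid⊆edgesAvoid/e : ∀ {w f} → w ≢ u → f ≢ e → f ∈ edgesAvoid G w → f ∈ edgesAvoid G/e w
  edgesAvoid⊆edgesAvoid/e w≢u f≢e f∈ =
    let (f∈E , end₁≢w , end₂≢w) = to (∈-edgesAvoid G) f∈
    in from (∈-edgesAvoid G/e) (from ∈-E/e (f∈E , f≢e) , identify-≢ w≢u end₁≢w , identify-≢ w≢u end₂≢w)

  edgesAvoid-u-v⊆edgesAvoid/e : ∀ {f} → f ≢ e → f ∈ edgesAvoid G u → f ∈ edgesAvoid G v → f ∈ edgesAvoid G/e u
  edgesAvoid-u-v⊆edgesAvoid/e f≢e f∈u f∈v =
    let (f∈E , end₁≢u , end₂≢u) = to (∈-edgesAvoid G) f∈u
        (_   , end₁≢v , end₂≢v) = to (∈-edgesAvoid G) f∈v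
    in from (∈-edgesAvoid G/e)
         (from ∈-E/e (f∈E , f≢e) , identify-≢u end₁≢u end₁≢v , identify-≢u end₂≢u end₂≢v)

  loopsAt⊆loopsAt/e : ∀ {w w' f} → identify w ≡ w' → f ≢ e → f ∈ loopsAt G w → f ∈ loopsAt G/e w'
  loopsAt⊆loopsAt/e refl f≢e f∈ =
    let (f∈E , end₁≡w , end₂≡w) = to (∈-loopsAt G) f∈
    in from (∈-loopsAt G/e) (from ∈-E/e (f∈E , f≢e) , cong identify end₁≡w , cong identify end₂≡w)

  incident-u-v⇒loopsAt/e : ∀ {f} → u ≢ v → f ∈ E G → f ≢ e →
                           f ∉ edgesAvoid G u → f ∉ edgesAvoid G v → f ∈ loopsAt G/e u
  incident-u-v⇒loopsAt/e {f} u≢v f∈E f≢e f∉u f∉v =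
    from (∈-loopsAt G/e) (from ∈-E/e (f∈E , f≢e) , ends-identified
      (∉edgesAvoid⇒incident G f∈E f∉u) (∉edgesAvoid⇒incident G f∈E f∉v))
    where
      ends-identified : end₁ G f ≡ u ⊎ end₂ G f ≡ u → end₁ G f ≡ v ⊎ end₂ G f ≡ v →
                        identify (end₁ G f) ≡ u × identify (end₂ G f) ≡ u
      ends-identified (inj₁ a≡u) (inj₁ a≡v) = contradiction (trans (sym a≡u) a≡v) u≢v
      ends-identified (inj₁ a≡u) (inj₂ b≡v) = identify-incident (inj₁ a≡u) , identify-incident (inj₂ b≡v)
      ends-identified (inj₂ b≡u) (inj₁ a≡v) = identify-incident (inj₂ a≡v) , identify-incident (inj₁ b≡u)
      ends-identified (inj₂ b≡u) (inj₂ b≡v) = contradiction (trans (sym b≡u) b≡v) u≢v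

  edgesIn/e⊆edgesIn : ∀ {C' C} → (∀ {y} → identify y ∈ C' → y ∈ C) → edgesIn G/e C' ⊆ edgesIn G C
  edgesIn/e⊆edgesIn lift f∈ =
    let (f∈E/e , end₁∈ , end₂∈) = to (∈-edgesIn G/e) f∈
    in from (∈-edgesIn G) (proj₁ (to ∈-E/e f∈E/e) , lift end₁∈ , lift end₂∈)

  reach/e-avoids-v : ∀ {x y} → u ≢ v → x ≢ v → Reach G/e x y → y ≢ v
  reach/e-avoids-v u≢v x≢v ε                  = x≢v
  reach/e-avoids-v u≢v x≢v (adj f _  ◅ path) = reach/e-avoids-v u≢v (identify≢v u≢v (end₂ G f)) path
  reach/e-avoids-v u≢v x≢v (adj⁻ f _ ◅ path) = reach/e-avoids-v u≢v (identify≢v u≢v (end₁ G f)) path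

  v∉component/e : ∀ {C'} → u ≢ v → IsComponent G/e C' → v ∉ C'
  v∉component/e u≢v (x , x∈V/e , C'≡reach) v∈C' =
    reach/e-avoids-v u≢v (proj₂ (to ∈-V/e x∈V/e)) (to (C'≡reach v) v∈C') refl

  module _ (e∈E : e ∈ E G) where

    edgesAvoid/e∪e⊆edgesAvoid : ∀ {w} → w ≢ u → w ≢ v → edgesAvoid G/e w ∪ ⁅ e ⁆ ⊆ edgesAvoid G w
    edgesAvoid/e∪e⊆edgesAvoid w≢u w≢v =
      ∪-⊆ (edgesAvoid/e⊆edgesAvoid w≢v) (⁅⁆-⊆ (from (∈-edgesAvoid G) (e∈E , w≢u ∘ sym , w≢v ∘ sym)))

    reach-identify : ∀ w → Reach G w (identify w)
    reach-identify w with w ≟ v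
    ... | yes refl = adj⁻ e e∈E ◅ ε
    ... | no _     = ε

    reach-identify⁻ : ∀ w → Reach G (identify w) w
    reach-identify⁻ w with w ≟ v
    ... | yes refl = adj e e∈E ◅ ε
    ... | no _     = ε

    reach/e⇒reach : ∀ {x y} → Reach G/e x y → Reach G x y
    reach/e⇒reach ε = ε
    reach/e⇒reach (adj f f∈ ◅ path) =
      reach-identify⁻ (end₁ G f) ◅◅ adj f (proj₁ (to ∈-E/e f∈)) ◅ reach-identify (end₂ G f)
        ◅◅ reach/e⇒reach path
    reach/e⇒reach (adj⁻ f f∈ ◅ path) =
      reach-identify⁻ (end₂ G f) ◅◅ adj⁻ f (proj₁ (to ∈-E/e f∈)) ◅ reach-identify (end₁ G f)
        ◅◅ reach/e⇒reach path

    reach⇒reach/e : ∀ {x y} → Reach G x y → Reach G/e (identify x) (identify y)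
    reach⇒reach/e ε = ε
    reach⇒reach/e {y = y} (adj f f∈ ◅ path) with f ≟ e
    ... | yes refl = subst (λ z → Reach G/e z (identify y)) (sym identify-u≡identify-v)
                           (reach⇒reach/e path)
    ... | no f≢e  = adj f (from ∈-E/e (f∈ , f≢e)) ◅ reach⇒reach/e path
    reach⇒reach/e {y = y} (adj⁻ f f∈ ◅ path) with f ≟ e
    ... | yes refl = subst (λ z → Reach G/e z (identify y)) identify-u≡identify-v (reach⇒reach/e path)
    ... | no f≢e  = adj⁻ f (from ∈-E/e (f∈ , f≢e)) ◅ reach⇒reach/e path

    reach/e⇔reach : ∀ {x y} → Reach G/e (identify x) (identify y) ⇔ Reach G x y
    reach/e⇔reach {x} {y} = mk⇔
      (λ path → reach-identify x ◅◅ reach/e⇒reach path ◅◅ reach-identify⁻ y)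
      reach⇒reach/e

    preimage-isComponent : ∀ {C' C} → IsComponent G/e C' → (∀ y → y ∈ C ⇔ identify y ∈ C') → IsComponent G C
    preimage-isComponent (x , x∈V/e , C'≡reach) C≡preimage with to ∈-V/e x∈V/e
    ... | x∈V , x≢v = x , x∈V , λ y →
      ⇔.trans (C≡preimage y) (⇔.trans (C'≡reach (identify y))
        (subst (λ z → Reach G/e z (identify y) ⇔ Reach G x y) (identify-≢v x≢v) reach/e⇔reach))

  module _ {C' : Subset n} (v∉C' : v ∉ C') where

    ∪⁅v⁆-preimage : u ∈ C' → ∀ y → y ∈ C' ∪ ⁅ v ⁆ ⇔ identify y ∈ C'
    ∪⁅v⁆-preimage u∈C' y with y ≟ v
    ... | yes refl = mk⇔ (λ _ → u∈C') (λ _ → q⊆p∪q C' ⁅ v ⁆ (x∈⁅x⁆ v))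
    ... | no y≢v  = mk⇔ ([ id , (λ y∈⁅v⁆ → contradiction (x∈⁅y⁆⇒x≡y v y∈⁅v⁆) y≢v) ] ∘ x∈p∪q⁻ C' ⁅ v ⁆)
                        (p⊆p∪q ⁅ v ⁆)

    self-preimage : u ∉ C' → ∀ y → y ∈ C' ⇔ identify y ∈ C'
    self-preimage u∉C' y with y ≟ v
    ... | yes refl = mk⇔ (λ v∈C' → contradiction v∈C' v∉C') (λ u∈C' → contradiction u∈C' u∉C')
    ... | no _     = ⇔.refl

module WeakFrameworkProperties {n m : ℕ} {G : Graph n m} {M : MatroidData m}
                               (isM : IsMatroid M) (W : WeakFramework G M) where
  open WeakFramework W
  open MatroidProperties isM

  E⊆ground : E G ⊆ ground M
  E⊆ground = subst (E G ⊆_) wf-edges id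

  ground⊆E : ground M ⊆ E G
  ground⊆E = subst (_⊆ E G) wf-edges id

  edgesAvoid⊆ground : ∀ w → edgesAvoid G w ⊆ ground M
  edgesAvoid⊆ground w = E⊆ground ∘ proj₁ ∘ to (∈-edgesAvoid G)

  edgesIn⊆ground : ∀ C → edgesIn G C ⊆ ground M
  edgesIn⊆ground C = E⊆ground ∘ edgesIn⊆E G C

  InCl-⊆edgesAvoid : ∀ {t Y f} → t ∈ V G → Y ⊆ edgesAvoid G t → InCl M Y f →
                     f ∈ edgesAvoid G t ⊎ f ∈ loopsAt G t
  InCl-⊆edgesAvoid {t} {f = f} t∈V Y⊆ clY = wf-cl t t∈V f (InCl-mono Y⊆ (edgesAvoid⊆ground t) clY)

  nonloop-∉InCl-edgesAvoid : ∀ {e t} → ¬ IsLoop G e → t ∈ V G → end₁ G e ≡ t ⊎ end₂ G e ≡ t →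
                             ¬ InCl M (edgesAvoid G t) e
  nonloop-∉InCl-edgesAvoid {e} {t} e-nonloop t∈V incident cl with wf-cl t t∈V e cl
  ... | inj₁ e∈ = let (_ , end₁≢t , end₂≢t) = to (∈-edgesAvoid G) e∈ in [ end₁≢t , end₂≢t ] incident
  ... | inj₂ e∈ = let (_ , end₁≡t , end₂≡t) = to (∈-loopsAt G) e∈ in e-nonloop (trans end₁≡t (sym end₂≡t))

module ContractedWeakFramework {n m : ℕ} {G : Graph n m} {M : MatroidData m}
                               (wfG : WellFormed G) (isM : IsMatroid M) (W : WeakFramework G M)
                               {e : Fin m} (e∈E : e ∈ E G) (e-nonloop : ¬ IsLoop G e) where
  open IsMatroid isM
  open WeakFramework W
  open MatroidProperties isM
  open WeakFrameworkProperties isM W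
  open Contraction G e
  open ≤-Reasoning

  u≢v : u ≢ v
  u≢v = e-nonloop

  u∈V : u ∈ V G
  u∈V = proj₁ (wfG e e∈E)

  v∈V : v ∈ V G
  v∈V = proj₂ (wfG e e∈E)

  e∈ground : e ∈ ground M
  e∈ground = E⊆ground e∈E

  0<rank⁅e⁆ : 0 < rank M ⁅ e ⁆
  0<rank⁅e⁆ = ¬InCl⇒0<rank⁅⁆ (edgesAvoid⊆ground v) e∈ground
                (nonloop-∉InCl-edgesAvoid e-nonloop v∈V (inj₂ refl))

  E/e⊆ground : E G/e ⊆ ground M
  E/e⊆ground = E⊆ground ∘ proj₁ ∘ to ∈-E/e

  wf-comp/e : ∀ C' → IsComponent G/e C' → rank (contractM M e) (edgesIn G/e C') ≤ ∣ C' ∣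
  wf-comp/e C' isC' with u ∈? C'
  ... | yes u∈C' = begin
      rank M (X' ∪ ⁅ e ⁆) ∸ rank M ⁅ e ⁆  ≤⟨ ∸-mono bound 0<rank⁅e⁆ ⟩
      (∣ C' ∣ + 1) ∸ 1                    ≡⟨ m+n∸n≡m ∣ C' ∣ 1 ⟩
      ∣ C' ∣                              ∎
    where
      X' = edgesIn G/e C'
      C = C' ∪ ⁅ v ⁆
      C≡preimage = ∪⁅v⁆-preimage (v∉component/e u≢v isC') u∈C'
      e∈edgesIn-C : e ∈ edgesIn G C
      e∈edgesIn-C = from (∈-edgesIn G) (e∈E , p⊆p∪q ⁅ v ⁆ u∈C' , q⊆p∪q C' ⁅ v ⁆ (x∈⁅x⁆ v))
      X'∪e⊆edgesIn-C : X' ∪ ⁅ e ⁆ ⊆ edgesIn G C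
      X'∪e⊆edgesIn-C = ∪-⊆ (edgesIn/e⊆edgesIn (from (C≡preimage _))) (⁅⁆-⊆ e∈edgesIn-C)
      bound : rank M (X' ∪ ⁅ e ⁆) ≤ ∣ C' ∣ + 1
      bound = begin
        rank M (X' ∪ ⁅ e ⁆)     ≤⟨ r-mono _ _ (edgesIn⊆ground C) X'∪e⊆edgesIn-C ⟩
        rank M (edgesIn G C)    ≤⟨ wf-comp C (preimage-isComponent e∈E isC' C≡preimage) ⟩
        ∣ C ∣                   ≤⟨ ∣p∪q∣≤∣p∣+∣q∣ C' ⁅ v ⁆ ⟩
        ∣ C' ∣ + ∣ ⁅ v ⁆ ∣      ≡⟨ cong (∣ C' ∣ +_) (∣⁅x⁆∣≡1 v) ⟩
        ∣ C' ∣ + 1              ∎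
  ... | no u∉C' = begin
      rank (contractM M e) X'  ≤⟨ rank-contract≤rank (E/e⊆ground ∘ edgesIn⊆E G/e C') e∈ground ⟩
      rank M X'                ≤⟨ r-mono _ _ (edgesIn⊆ground C')
                                    (edgesIn/e⊆edgesIn (from (C'≡preimage _))) ⟩
      rank M (edgesIn G C')    ≤⟨ wf-comp C' (preimage-isComponent e∈E isC' C'≡preimage) ⟩
      ∣ C' ∣                   ∎
    where
      X' = edgesIn G/e C'
      C'≡preimage = self-preimage (v∉component/e u≢v isC') u∉C'

  edgesAvoid/e⊆ground : ∀ w → edgesAvoid G/e w ⊆ ground M
  edgesAvoid/e⊆ground w = E/e⊆ground ∘ proj₁ ∘ to (∈-edgesAvoid G/e)

  InCl-∪e⇒edgesAvoid/e : ∀ {w f} → w ∈ V G → w ≢ u → w ≢ v → f ≢ e →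
                         InCl M (edgesAvoid G/e w ∪ ⁅ e ⁆) f → f ∈ edgesAvoid G/e w ⊎ f ∈ loopsAt G/e w
  InCl-∪e⇒edgesAvoid/e w∈V w≢u w≢v f≢e cl
    with InCl-⊆edgesAvoid w∈V (edgesAvoid/e∪e⊆edgesAvoid e∈E w≢u w≢v) cl
  ... | inj₁ f∈ = inj₁ (edgesAvoid⊆edgesAvoid/e w≢u f≢e f∈)
  ... | inj₂ f∈ = inj₂ (loopsAt⊆loopsAt/e (identify-≢v w≢v) f≢e f∈)

  InCl-edgesAvoid/e-u : ∀ {f} → f ≢ e → InCl M (edgesAvoid G/e u) f → f ∈ edgesAvoid G/e u ⊎ f ∈ loopsAt G/e u
  InCl-edgesAvoid/e-u f≢e cl
    with InCl-⊆edgesAvoid u∈V (edgesAvoid/e⊆edgesAvoid u≢v) cl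
       | InCl-⊆edgesAvoid v∈V edgesAvoid/e-u⊆edgesAvoid-v cl
  ... | inj₂ f∈loops-u | _              = inj₂ (loopsAt⊆loopsAt/e identify-u f≢e f∈loops-u)
  ... | inj₁ _         | inj₂ f∈loops-v = inj₂ (loopsAt⊆loopsAt/e identify-v f≢e f∈loops-v)
  ... | inj₁ f∈avoid-u | inj₁ f∈avoid-v = inj₁ (edgesAvoid-u-v⊆edgesAvoid/e f≢e f∈avoid-u f∈avoid-v)

  -- If f avoided an end t of e, then e would be spanned by E(G - t).
  InCl-∪f⇒loopsAt/e-u : ∀ {f} → f ∈ E G → f ≢ e → InCl M (edgesAvoid G/e u ∪ ⁅ f ⁆) e → f ∈ loopsAt G/e u
  InCl-∪f⇒loopsAt/e-u {f} f∈E f≢e e∈cl =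
    incident-u-v⇒loopsAt/e u≢v f∈E f≢e
      (f∉edgesAvoid u∈V (inj₁ refl) (edgesAvoid/e⊆edgesAvoid u≢v))
      (f∉edgesAvoid v∈V (inj₂ refl) edgesAvoid/e-u⊆edgesAvoid-v)
    where
      f∉edgesAvoid : ∀ {t} → t ∈ V G → u ≡ t ⊎ v ≡ t → edgesAvoid G/e u ⊆ edgesAvoid G t → f ∉ edgesAvoid G t
      f∉edgesAvoid {t} t∈V incident X⊆ f∈ =
        nonloop-∉InCl-edgesAvoid e-nonloop t∈V incident
          (InCl-mono (∪-⊆ X⊆ (⁅⁆-⊆ f∈)) (edgesAvoid⊆ground t) e∈cl)

  InCl-∪e⇒edgesAvoid/e-u : ∀ {f} → f ≢ e → InCl M (edgesAvoid G/e u ∪ ⁅ e ⁆) f →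
                           f ∈ edgesAvoid G/e u ⊎ f ∈ loopsAt G/e u
  InCl-∪e⇒edgesAvoid/e-u f≢e cl with InCl-exchange (edgesAvoid/e⊆ground u) e∈ground cl
  ... | inj₁ f∈clX  = InCl-edgesAvoid/e-u f≢e f∈clX
  ... | inj₂ e∈clXf = inj₂ (InCl-∪f⇒loopsAt/e-u (ground⊆E (proj₁ cl)) f≢e e∈clXf)

  wf-cl/e : ∀ w → w ∈ V G/e → ∀ f → InCl (contractM M e) (edgesAvoid G/e w) f →
            f ∈ edgesAvoid G/e w ⊎ f ∈ loopsAt G/e w
  wf-cl/e w w∈V/e f cl with InCl-contract (edgesAvoid/e⊆ground w) e∈ground cl | w ≟ u
  ... | clXe , f≢e | yes refl = InCl-∪e⇒edgesAvoid/e-u f≢e clXe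
  ... | clXe , f≢e | no w≢u   =
    let (w∈V , w≢v) = to ∈-V/e w∈V/e in InCl-∪e⇒edgesAvoid/e w∈V w≢u w≢v f≢e clXe

  weakFramework/e : WeakFramework G/e (contractM M e)
  weakFramework/e = record
    { wf-edges = cong (_∩ ∁ ⁅ e ⁆) wf-edges
    ; wf-comp  = wf-comp/e
    ; wf-cl    = wf-cl/e
    }

lemma2p8 : {n m : ℕ} (G : Graph n m) (M : MatroidData m) → WellFormed G → IsMatroid M →
           WeakFramework G M → (e : Fin m) → e ∈ E G → ¬ IsLoop G e →
           WeakFramework (contractG G e) (contractM M e)
lemma2p8 G M wfG isM W e e∈E e-nonloop = ContractedWeakFramework.weakFramework/e wfG isM W e∈E e-nonloop
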